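{- Let $n>1$, let $q,p_0,\ldots,p_{n-1}$ be non-zero integers with $\gcd(p_i,q)=1$ for all $i$, and assume $D:=q^n-p_0p_1\cdots p_{n-1}\neq 0$. For integers $j\ge 0$ put $U_j=\frac{q^j}{D}$. Let $\alpha,\beta$ be non-zero integers and $b$ an integer with $0<b<n$. If $\alpha U_0+\beta U_b$ is an integer, then for every $i=0,1,2,\ldots$ the numbers $\alpha U_i+\beta U_{i+b}$ and $p_0p_1\cdots p_{n-1}\,\beta\, U_i+\alpha U_{n+i-b}$ are also integers.
   Context: The numbers $U_j=\frac{q^j}{q^n-p_0\cdots p_{n-1}}$ are defined for all non-negative integers $j$; the denominator is implicitly assumed non-zero. -}

module Defs where

open import Data.Nat using (ℕ; zero; suc)
open import Data.Fin using (Fin; zero; suc)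
open import Data.Integer as ℤ using (ℤ; _*_; _^_; _-_; 1ℤ; 0ℤ)
open import Data.Rational as ℚ using (ℚ; _÷_; 0ℚ)
open import Data.Rational.Literals using (fromℤ)
open import Data.Product using (∃)
open import Relation.Binary.PropositionalEquality using (_≡_; _≢_; cong)

∏ : ∀ n → (Fin n → ℤ) → ℤ
∏ zero    p = 1ℤ
∏ (suc n) p = p zero * ∏ n (λ i → p (suc i))

Dval : ∀ n → ℤ → (Fin n → ℤ) → ℤ
Dval n q p = q ^ n - ∏ n p

fromℤ-nonZero : ∀ {d : ℤ} → d ≢ 0ℤ → ℚ.NonZero (fromℤ d)
fromℤ-nonZero {d} d≢0 = ℚ.≢-nonZero {fromℤ d} (λ eq → d≢0 (cong ℚ.numerator eq))

U : ∀ n (q : ℤ) (p : Fin n → ℤ) → Dval n q p ≢ 0ℤ → ℕ → ℚ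
U n q p D≢0 j = _÷_ (fromℤ (q ^ j)) (fromℤ (Dval n q p)) {{fromℤ-nonZero D≢0}}

IsInteger : ℚ → Set
IsInteger x = ∃ λ (z : ℤ) → x ≡ fromℤ z

-- Write P = p₀ ⋯ p_{n-1}, m = n - b and x_j = α U_j + β U_{j+b}. Since U_{i+j} = q^i U_j, every
-- x_i = q^i x₀ is an integer. Since q^n = D + P, we have U_n = 1 + P U₀, hence
-- q^m x₀ = α U_m + β U_n = α U_m + P β U₀ + β, so P β U₀ + α U_m is an integer and so are its
-- q^i-multiples P β U_i + α U_{m+i}.
module Submission where

open import Defs
open import Data.Nat using (ℕ; _<_; _≤_; _+_; _∸_)
open import Data.Nat.Properties using (+-identityʳ; +-comm; +-∸-comm; m∸n+n≡m; <⇒≤)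
open import Data.Fin using (Fin)
open import Data.Integer as ℤ using (ℤ; 0ℤ; 1ℤ)
open import Data.Integer.GCD using (gcd)
open import Data.Rational using (ℚ; NonZero; 1ℚ; 1/_; -_; _-_) renaming (_+_ to _+ℚ_; _*_ to _*ℚ_)
open import Data.Rational.Literals using (fromℤ)
open import Data.Rational.Properties
  using (toℚᵘ-injective; toℚᵘ-homo-+; toℚᵘ-homo-*; *-assoc; *-inverseʳ)
open import Data.Rational.Solver using (module +-*-Solver)
import Data.Rational.Unnormalised as ℚᵘ
import Data.Rational.Unnormalised.Properties as ℚᵘ
import Data.Integer.Properties as ℤ
open import Data.Product using (_×_; _,_)
open import Relation.Binary.PropositionalEquality
  using (_≡_; _≢_; refl; sym; trans; cong; cong₂; subst; module ≡-Reasoning)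

open +-*-Solver
open ≡-Reasoning

fromℤ-* : ∀ a b → fromℤ (a ℤ.* b) ≡ fromℤ a *ℚ fromℤ b
fromℤ-* a b = toℚᵘ-injective (ℚᵘ.≃-sym (toℚᵘ-homo-* (fromℤ a) (fromℤ b)))

fromℤ-+ : ∀ a b → fromℤ (a ℤ.+ b) ≡ fromℤ a +ℚ fromℤ b
fromℤ-+ a b = toℚᵘ-injective (ℚᵘ.≃-trans
  (ℚᵘ.*≡* (cong (ℤ._* 1ℤ) (cong₂ ℤ._+_ (sym (ℤ.*-identityʳ a)) (sym (ℤ.*-identityʳ b)))))
  (ℚᵘ.≃-sym (toℚᵘ-homo-+ (fromℤ a) (fromℤ b))))

fromℤ-neg : ∀ a → fromℤ (ℤ.- a) ≡ - fromℤ a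
fromℤ-neg (ℤ.+ 0)     = refl
fromℤ-neg ℤ.+[1+ _ ]  = refl
fromℤ-neg ℤ.-[1+ _ ]  = refl

fromℤ-- : ∀ a b → fromℤ (a ℤ.- b) ≡ fromℤ a - fromℤ b
fromℤ-- a b = trans (fromℤ-+ a (ℤ.- b)) (cong (fromℤ a +ℚ_) (fromℤ-neg b))

IsInteger-*ˡ : ∀ k {x} → IsInteger x → IsInteger (fromℤ k *ℚ x)
IsInteger-*ˡ k (z , x≡z) = k ℤ.* z , trans (cong (fromℤ k *ℚ_) x≡z) (sym (fromℤ-* k z))

IsInteger--ʳ : ∀ {x} → IsInteger x → ∀ k → IsInteger (x - fromℤ k)
IsInteger--ʳ (z , x≡z) k = z ℤ.- k , trans (cong (_- fromℤ k) x≡z) (sym (fromℤ-- z k))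

module _ (n : ℕ) (q : ℤ) (p : Fin n → ℤ) (D≢0 : Dval n q p ≢ 0ℤ) where

  private
    instance
      D≢0ℚ : NonZero (fromℤ (Dval n q p))
      D≢0ℚ = fromℤ-nonZero D≢0

    U′ : ℕ → ℚ
    U′ = U n q p D≢0

    r : ℚ
    r = 1/ fromℤ (Dval n q p)

  U-+ : ∀ i j → U′ (i + j) ≡ fromℤ (q ℤ.^ i) *ℚ U′ j
  U-+ i j = begin
    fromℤ (q ℤ.^ (i + j)) *ℚ r                  ≡⟨ cong (λ t → fromℤ t *ℚ r) (ℤ.^-distribˡ-+-* q i j) ⟩
    fromℤ (q ℤ.^ i ℤ.* q ℤ.^ j) *ℚ r            ≡⟨ cong (_*ℚ r) (fromℤ-* (q ℤ.^ i) (q ℤ.^ j)) ⟩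
    fromℤ (q ℤ.^ i) *ℚ fromℤ (q ℤ.^ j) *ℚ r     ≡⟨ *-assoc (fromℤ (q ℤ.^ i)) (fromℤ (q ℤ.^ j)) r ⟩
    fromℤ (q ℤ.^ i) *ℚ (fromℤ (q ℤ.^ j) *ℚ r)   ∎

  U-shift : ∀ i → U′ i ≡ fromℤ (q ℤ.^ i) *ℚ U′ 0
  U-shift i = trans (cong U′ (sym (+-identityʳ i))) (U-+ i 0)

  U-n : U′ n ≡ 1ℚ +ℚ fromℤ (∏ n p) *ℚ U′ 0
  U-n = begin
    Qⁿ *ℚ r                               ≡⟨ solve 3 (λ Qⁿ P r → Qⁿ :* r := (Qⁿ :- P) :* r :+ P :* (con 1ℚ :* r)) refl Qⁿ P r ⟩
    (Qⁿ - P) *ℚ r +ℚ P *ℚ (1ℚ *ℚ r)       ≡⟨ cong (λ t → t *ℚ r +ℚ P *ℚ (1ℚ *ℚ r)) (sym (fromℤ-- (q ℤ.^ n) (∏ n p))) ⟩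
    fromℤ (Dval n q p) *ℚ r +ℚ P *ℚ U′ 0  ≡⟨ cong (_+ℚ P *ℚ U′ 0) (*-inverseʳ (fromℤ (Dval n q p))) ⟩
    1ℚ +ℚ P *ℚ U′ 0                       ∎
    where
    Qⁿ P : ℚ
    Qⁿ = fromℤ (q ℤ.^ n)
    P  = fromℤ (∏ n p)

  comb : ℚ → ℚ → ℕ → ℕ → ℚ
  comb a c k j = a *ℚ U′ j +ℚ c *ℚ U′ (j + k)

  comb-shift : ∀ a c k i → comb a c k i ≡ fromℤ (q ℤ.^ i) *ℚ comb a c k 0
  comb-shift a c k i = begin
    a *ℚ U′ i +ℚ c *ℚ U′ (i + k)                 ≡⟨ cong₂ (λ s t → a *ℚ s +ℚ c *ℚ t) (U-shift i) (U-+ i k) ⟩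
    a *ℚ (Qⁱ *ℚ U′ 0) +ℚ c *ℚ (Qⁱ *ℚ U′ k)       ≡⟨ solve 5 (λ a c Q u v → a :* (Q :* u) :+ c :* (Q :* v) := Q :* (a :* u :+ c :* v)) refl a c Qⁱ (U′ 0) (U′ k) ⟩
    Qⁱ *ℚ (a *ℚ U′ 0 +ℚ c *ℚ U′ k)               ∎
    where
    Qⁱ : ℚ
    Qⁱ = fromℤ (q ℤ.^ i)

  comb-dual : ∀ a c k → k ≤ n →
              comb (fromℤ (∏ n p) *ℚ c) a (n ∸ k) 0 ≡ fromℤ (q ℤ.^ (n ∸ k)) *ℚ comb a c k 0 - c
  comb-dual a c k k≤n = sym (begin
    Qᵐ *ℚ (a *ℚ U′ 0 +ℚ c *ℚ U′ k) - c                 ≡⟨ cong (_- c) (sym (comb-shift a c k (n ∸ k))) ⟩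
    a *ℚ U′ (n ∸ k) +ℚ c *ℚ U′ (n ∸ k + k) - c         ≡⟨ cong (λ j → a *ℚ U′ (n ∸ k) +ℚ c *ℚ U′ j - c) (m∸n+n≡m k≤n) ⟩
    a *ℚ U′ (n ∸ k) +ℚ c *ℚ U′ n - c                   ≡⟨ cong (λ t → a *ℚ U′ (n ∸ k) +ℚ c *ℚ t - c) U-n ⟩
    a *ℚ U′ (n ∸ k) +ℚ c *ℚ (1ℚ +ℚ P *ℚ U′ 0) - c      ≡⟨ solve 5 (λ a c P u v → a :* v :+ c :* (con 1ℚ :+ P :* u) :- c := P :* c :* u :+ a :* v) refl a c P (U′ 0) (U′ (n ∸ k)) ⟩
    P *ℚ c *ℚ U′ 0 +ℚ a *ℚ U′ (n ∸ k)                  ∎)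
    where
    Qᵐ P : ℚ
    Qᵐ = fromℤ (q ℤ.^ (n ∸ k))
    P  = fromℤ (∏ n p)

lemma2p2 : (n : ℕ) → 1 < n → (q : ℤ) → (p : Fin n → ℤ) →
    q ≢ 0ℤ → (∀ i → p i ≢ 0ℤ) → (∀ i → gcd (p i) q ≡ 1ℤ) →
    (D≢0 : Dval n q p ≢ 0ℤ) →
    (α β : ℤ) → α ≢ 0ℤ → β ≢ 0ℤ → (b : ℕ) → 0 < b → b < n →
    IsInteger ((fromℤ α *ℚ U n q p D≢0 0) +ℚ (fromℤ β *ℚ U n q p D≢0 b)) →
    (i : ℕ) →
    IsInteger ((fromℤ α *ℚ U n q p D≢0 i) +ℚ (fromℤ β *ℚ U n q p D≢0 (i + b)))
    × IsInteger ((fromℤ (∏ n p) *ℚ fromℤ β *ℚ U n q p D≢0 i) +ℚ (fromℤ α *ℚ U n q p D≢0 (n + i ∸ b)))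
lemma2p2 n _ q p _ _ _ D≢0 α β _ _ b _ b<n x₀∈ℤ i =
  subst IsInteger (sym (comb-shift n q p D≢0 (fromℤ α) (fromℤ β) b i)) (IsInteger-*ˡ (q ℤ.^ i) x₀∈ℤ) ,
  subst IsInteger (sym dualᵢ≡) (IsInteger-*ˡ (q ℤ.^ i) dual₀∈ℤ)
  where
  b≤n : b ≤ n
  b≤n = <⇒≤ b<n

  Pβ : ℚ
  Pβ = fromℤ (∏ n p) *ℚ fromℤ β

  dual₀∈ℤ : IsInteger (comb n q p D≢0 Pβ (fromℤ α) (n ∸ b) 0)
  dual₀∈ℤ = subst IsInteger (sym (comb-dual n q p D≢0 (fromℤ α) (fromℤ β) b b≤n))
                  (IsInteger--ʳ (IsInteger-*ˡ (q ℤ.^ (n ∸ b)) x₀∈ℤ) β)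

  dualᵢ≡ : Pβ *ℚ U n q p D≢0 i +ℚ fromℤ α *ℚ U n q p D≢0 (n + i ∸ b)
         ≡ fromℤ (q ℤ.^ i) *ℚ comb n q p D≢0 Pβ (fromℤ α) (n ∸ b) 0
  dualᵢ≡ = trans (cong (λ j → Pβ *ℚ U n q p D≢0 i +ℚ fromℤ α *ℚ U n q p D≢0 j)
                       (trans (+-∸-comm i b≤n) (+-comm (n ∸ b) i)))
                 (comb-shift n q p D≢0 Pβ (fromℤ α) (n ∸ b) i)
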